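{- Let $\mathcal{C}=\{C_1,\dots,C_k\}$ be a set of vertex-disjoint cycles and let $f=uv$ be an edge not in $E(\mathcal{C})$ (all in a complete graph). Then the edge set $\{f\}\cup E(\mathcal{C})$ can be odd-covered using two paths whose vertices are contained in $\{u,v\}\cup V(\mathcal{C})$. Moreover, for every vertex $z\in V(\mathcal{C})\setminus \{u,v\}$, the two paths in the odd-cover can be chosen to have $z$ as a common endpoint, unless $k\geq 2$ and for some $j\in[k]$ we have $u,v,z\in V(C_j)$.
   Context: Graphs are simple; cycles have at least three vertices. $V(\mathcal C)=\bigcup_i V(C_i)$, $E(\mathcal C)=\bigcup_i E(C_i)$. A set $F$ of edges of a complete graph is odd-covered by paths $P_1,\dots,P_m$ of that complete graph if $E(P_1)\oplus\cdots\oplus E(P_m)=F$, where $\oplus$ denotes symmetric difference. -}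

module Defs where

open import Data.Nat using (ℕ; _≥_)
open import Data.Fin using (Fin)
open import Data.List using (List; []; _∷_; _++_; head; last; length)
open import Data.List.Membership.Propositional using (_∈_)
open import Data.List.Relation.Unary.All using (All)
open import Data.List.Relation.Unary.Unique.Propositional using (Unique)
open import Data.Maybe using (just)
open import Data.Product using (_×_; ∃; ∃-syntax; Σ-syntax)
open import Data.Sum using (_⊎_)
open import Data.Empty using (⊥)
open import Relation.Nullary using (¬_)
open import Relation.Binary.PropositionalEquality using (_≡_; _≢_)

-- Vertices of the complete graph K_n are Fin n; every pair of distinct
-- vertices is an edge.  Edges are unordered: a predicate E on ordered
-- pairs, read as "E x y or E y x".

module _ {n : ℕ} where

  V : Set
  V = Fin n

  SameEdge : V → V → V → V → Set
  SameEdge a b x y = (x ≡ a × y ≡ b) ⊎ (x ≡ b × y ≡ a)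

  SeqEdge : List V → V → V → Set
  SeqEdge []            x y = ⊥
  SeqEdge (a ∷ [])      x y = ⊥
  SeqEdge (a ∷ b ∷ rest) x y = SameEdge a b x y ⊎ SeqEdge (b ∷ rest) x y

  -- a path: a nonempty sequence of distinct vertices (in K_n consecutive
  -- vertices are always adjacent); a single vertex is a trivial path
  IsPath : List V → Set
  IsPath p = Unique p × (p ≢ [])

  PathEdge : List V → V → V → Set
  PathEdge = SeqEdge

  IsCycle : List V → Set
  IsCycle c = Unique c × (length c ≥ 3)

  CycleEdge : List V → V → V → Set
  CycleEdge []      x y = ⊥
  CycleEdge (a ∷ c) x y = SeqEdge ((a ∷ c) ++ (a ∷ [])) x y

  InVC : {k : ℕ} → (Fin k → List V) → V → Set
  InVC Cs x = ∃[ i ] (x ∈ Cs i)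

  InEC : {k : ℕ} → (Fin k → List V) → V → V → Set
  InEC Cs x y = ∃[ i ] CycleEdge (Cs i) x y

  VertexDisjointCycles : {k : ℕ} → (Fin k → List V) → Set
  VertexDisjointCycles Cs =
    (∀ i → IsCycle (Cs i)) ×
    (∀ i j → i ≢ j → ∀ x → x ∈ Cs i → x ∈ Cs j → ⊥)

  Xor : Set → Set → Set
  Xor A B = (A × ¬ B) ⊎ (¬ A × B)

  OddCovered2 : (V → V → Set) → List V → List V → Set
  OddCovered2 F P₁ P₂ =
    ∀ x y → (F x y → Xor (PathEdge P₁ x y) (PathEdge P₂ x y))
          × (Xor (PathEdge P₁ x y) (PathEdge P₂ x y) → F x y)

  IsEndpoint : V → List V → Set
  IsEndpoint z p = (head p ≡ just z) ⊎ (last p ≡ just z)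

  Target : {k : ℕ} → (Fin k → List V) → V → V → V → V → Set
  Target Cs u v x y = SameEdge u v x y ⊎ InEC Cs x y

  GoodCover : {k : ℕ} → (Fin k → List V) → V → V → List V → List V → Set
  GoodCover Cs u v P₁ P₂ =
    IsPath P₁ × IsPath P₂ ×
    All (λ x → x ≡ u ⊎ x ≡ v ⊎ InVC Cs x) P₁ ×
    All (λ x → x ≡ u ⊎ x ≡ v ⊎ InVC Cs x) P₂ ×
    OddCovered2 (Target Cs u v) P₁ P₂

{-# OPTIONS --safe #-}

-- Start with P₁ = v u, P₂ = v; or, if v lies on a cycle C, pick t ∈ C other than u, v
-- and let P₁, P₂ be the two t–v arcs of C, with u appended to the arc avoiding it.  Then
-- absorb the remaining cycles one at a time at the common endpoint t: for a fresh cycle C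
-- pick w ∈ C with w ≠ u and a neighbour d ≠ u of w on C, extend P₁ by t d w and P₂ by t d
-- followed by the path around C from d to w.  The edge td is added twice and cancels,
-- while dw together with that path is E(C).  P₂ never meets u and d, w ≠ u, so both stay
-- paths.  Absorbing the cycle through z last, with w = z, makes z the common endpoint; if
-- that cycle contains v, exchange u and v; if it contains u and v as well it is the only
-- cycle, and the start with t = z already finishes.
module Submission where

open import Defs
open import Data.Nat using (ℕ; zero; suc; _≥_; _≤?_; s≤s; z≤n)
open import Data.Fin using (Fin; zero; _≟_)
open import Data.Fin.Properties using (any?)
open import Data.Bool using (Bool; false; _xor_)
open import Data.Bool.Properties using (xor-comm; xor-assoc; xor-identityʳ)
open import Data.Bool.Solver using (module xor-∧-Solver)
open import Data.List using (List; []; _∷_; _++_; [_]; reverse; filter; allFin)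
open import Data.List.Properties using (++-assoc; ++-identityʳ; reverse-++; unfold-reverse)
open import Data.List.Membership.Propositional using (_∈_; _∉_)
open import Data.List.Membership.Propositional.Properties using (∈-++⁺ˡ; ∈-++⁺ʳ; ∈-++⁻; ∈-∃++; ∈-filter⁺; ∈-filter⁻; ∈-allFin)
open import Data.List.Relation.Unary.Any using (here; there)
open import Data.List.Relation.Unary.Any.Properties using (reverse⁻)
open import Data.List.Relation.Unary.All as All using (All; []; _∷_)
open import Data.List.Relation.Unary.All.Properties using (¬Any⇒All¬; ++⁻ˡ; ++⁻ʳ) renaming (++⁺ to All-++⁺)
open import Data.List.Relation.Unary.AllPairs using ([]; _∷_)
open import Data.List.Relation.Unary.Unique.Propositional using (Unique)
open import Data.List.Relation.Binary.Disjoint.Propositional using (Disjoint)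
open import Data.List.Relation.Unary.Unique.Propositional.Properties using (Unique[x∷xs]⇒x∉xs; filter⁺; allFin⁺) renaming (++⁺ to Unique-++⁺)
open import Data.Product using (_×_; _,_; proj₁; proj₂; ∃-syntax)
open import Data.Sum using (_⊎_; inj₁; inj₂; swap)
open import Data.Empty using (⊥-elim)
open import Function using (_∘_)
open import Relation.Nullary using (¬_; does; proof; Dec; yes; no)
open import Relation.Nullary.Reflects using (Reflects; ofʸ; ofⁿ; det)
open import Relation.Nullary.Decidable using (_×-dec_; _⊎-dec_; ¬?)
open import Relation.Binary.PropositionalEquality using (_≡_; _≢_; refl; sym; trans; cong; cong₂; subst; module ≡-Reasoning)
import Data.List.Relation.Binary.Permutation.Setoid as Permutation
import Data.List.Relation.Binary.Permutation.Setoid.Properties as PermutationProperties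
open import Relation.Binary.PropositionalEquality.Properties using (setoid)

module _ {A : Set} where

  Unique-∷⁺ : ∀ {x : A} {xs} → x ∉ xs → Unique xs → Unique (x ∷ xs)
  Unique-∷⁺ {xs = xs} x∉xs u = ¬Any⇒All¬ xs x∉xs ∷ u

  Unique-++⁻ˡ : ∀ (xs : List A) {ys} → Unique (xs ++ ys) → Unique xs
  Unique-++⁻ˡ []       _        = []
  Unique-++⁻ˡ (x ∷ xs) (p ∷ ps) = ++⁻ˡ xs p ∷ Unique-++⁻ˡ xs ps

  Unique-++⇒Disjoint : ∀ (xs : List A) {ys} → Unique (xs ++ ys) → Disjoint xs ys
  Unique-++⇒Disjoint (x ∷ xs) (p ∷ _) (here refl , a∈ys)  = All.lookup (++⁻ʳ xs p) a∈ys refl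
  Unique-++⇒Disjoint (x ∷ xs) (_ ∷ u) (there a∈xs , a∈ys) = Unique-++⇒Disjoint xs u (a∈xs , a∈ys)

  Unique-arc : ∀ (a : A) xs b ys → Unique (a ∷ xs ++ b ∷ ys) → Unique (a ∷ xs ++ [ b ])
  Unique-arc a xs b ys u = Unique-++⁻ˡ (a ∷ xs ++ [ b ]) (subst Unique (sym (++-assoc (a ∷ xs) [ b ] ys)) u)

  ∈-arc : ∀ {z} (a : A) xs b ys → z ∈ a ∷ xs ++ [ b ] → z ∈ a ∷ xs ++ b ∷ ys
  ∈-arc {z} a xs b ys z∈ = subst (z ∈_) (++-assoc (a ∷ xs) [ b ] ys) (∈-++⁺ˡ z∈)

  Unique-reverse : ∀ {xs : List A} → Unique xs → Unique (reverse xs)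
  Unique-reverse {xs} = Unique-resp-↭ (↭-sym (↭-reverse xs))
    where open PermutationProperties (setoid A) using (Unique-resp-↭; ↭-reverse)
          open Permutation (setoid A) using (↭-sym)

  ∷-∃∷ʳ : ∀ (a : A) as → ∃[ bs ] ∃[ b ] (a ∷ as ≡ bs ++ [ b ])
  ∷-∃∷ʳ a []       = [] , a , refl
  ∷-∃∷ʳ a (b ∷ as) with ∷-∃∷ʳ b as
  ... | bs , c , eq = a ∷ bs , c , cong (a ∷_) eq

module _ {A B : Set} where

  reflects-⇔ : ∀ {b} → (A → B) → (B → A) → Reflects A b → Reflects B b
  reflects-⇔ f g (ofʸ a)  = ofʸ (f a)
  reflects-⇔ f g (ofⁿ ¬a) = ofⁿ (λ b → ¬a (g b))

  reflects-same⇒⇔ : ∀ {b} → Reflects A b → Reflects B b → (A → B) × (B → A)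
  reflects-same⇒⇔ (ofʸ a)  (ofʸ b)  = (λ _ → b) , (λ _ → a)
  reflects-same⇒⇔ (ofⁿ ¬a) (ofⁿ ¬b) = (λ a → ⊥-elim (¬a a)) , (λ b → ⊥-elim (¬b b))

  xor-reflects-⊎ : ∀ {a b} → ¬ (A × B) → Reflects A a → Reflects B b → Reflects (A ⊎ B) (a xor b)
  xor-reflects-⊎ ¬ab (ofʸ a)  (ofʸ b)  = ofⁿ (λ _ → ¬ab (a , b))
  xor-reflects-⊎ ¬ab (ofʸ a)  (ofⁿ ¬b) = ofʸ (inj₁ a)
  xor-reflects-⊎ ¬ab (ofⁿ ¬a) (ofʸ b)  = ofʸ (inj₂ b)
  xor-reflects-⊎ ¬ab (ofⁿ ¬a) (ofⁿ ¬b) = ofⁿ λ { (inj₁ a) → ¬a a ; (inj₂ b) → ¬b b }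

  xor-reflects-Xor : ∀ {n a b} → Reflects A a → Reflects B b → Reflects (Xor {n} A B) (a xor b)
  xor-reflects-Xor (ofʸ a)  (ofʸ b)  = ofⁿ λ { (inj₁ (_ , ¬b)) → ¬b b ; (inj₂ (¬a , _)) → ¬a a }
  xor-reflects-Xor (ofʸ a)  (ofⁿ ¬b) = ofʸ (inj₁ (a , ¬b))
  xor-reflects-Xor (ofⁿ ¬a) (ofʸ b)  = ofʸ (inj₂ (¬a , b))
  xor-reflects-Xor (ofⁿ ¬a) (ofⁿ ¬b) = ofⁿ λ { (inj₁ (a , _)) → ¬a a ; (inj₂ (_ , b)) → ¬b b }

module _ where
  open xor-∧-Solver

  xor-cancel-common : ∀ a b c d e → (a xor (b xor c)) xor (d xor (b xor e)) ≡ (a xor d) xor (c xor e)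
  xor-cancel-common = solve 5 (λ a b c d e → (a :+ (b :+ c)) :+ (d :+ (b :+ e)) := (a :+ d) :+ (c :+ e)) refl

  xor-exchange : ∀ a b c → a xor (b xor c) ≡ b xor (a xor c)
  xor-exchange = solve 3 (λ a b c → a :+ (b :+ c) := b :+ (a :+ c)) refl

reverse-arc : ∀ {A : Set} (a : A) xs b → reverse (a ∷ xs ++ [ b ]) ≡ b ∷ reverse xs ++ [ a ]
reverse-arc a xs b = trans (unfold-reverse a (xs ++ [ b ])) (cong (_++ [ a ]) (reverse-++ xs [ b ]))

reverse-middle : ∀ {A : Set} xs (a : A) ys → reverse (xs ++ a ∷ ys) ≡ reverse ys ++ a ∷ reverse xs
reverse-middle xs a ys = begin
  reverse (xs ++ a ∷ ys)            ≡⟨ reverse-++ xs (a ∷ ys) ⟩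
  reverse (a ∷ ys) ++ reverse xs    ≡⟨ cong (_++ reverse xs) (unfold-reverse a ys) ⟩
  (reverse ys ++ [ a ]) ++ reverse xs ≡⟨ ++-assoc (reverse ys) [ a ] (reverse xs) ⟩
  reverse ys ++ a ∷ reverse xs      ∎
  where open ≡-Reasoning

sameEdge? : ∀ {n} (a b x y : Fin n) → Dec (SameEdge a b x y)
sameEdge? a b x y = (x ≟ a ×-dec y ≟ b) ⊎-dec (x ≟ b ×-dec y ≟ a)

module _ {n : ℕ} {x y : Fin n} where

  SameEdge-comm : ∀ {a b} → SameEdge a b x y → SameEdge b a x y
  SameEdge-comm = swap

  SameEdge-∈ : ∀ {a b} {l : List (Fin n)} → SameEdge a b x y → x ∈ l → y ∈ l → a ∈ l
  SameEdge-∈ (inj₁ (refl , refl)) x∈l y∈l = x∈l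
  SameEdge-∈ (inj₂ (refl , refl)) x∈l y∈l = y∈l

  SeqEdge-comm : ∀ ps → SeqEdge ps x y → SeqEdge ps y x
  SeqEdge-comm (a ∷ b ∷ ps) (inj₁ (inj₁ (p , q))) = inj₁ (inj₂ (q , p))
  SeqEdge-comm (a ∷ b ∷ ps) (inj₁ (inj₂ (p , q))) = inj₁ (inj₁ (q , p))
  SeqEdge-comm (a ∷ b ∷ ps) (inj₂ e)              = inj₂ (SeqEdge-comm (b ∷ ps) e)

  SeqEdge-∈ : ∀ ps → SeqEdge ps x y → x ∈ ps × y ∈ ps
  SeqEdge-∈ (a ∷ b ∷ ps) (inj₁ (inj₁ (refl , refl))) = here refl , there (here refl)
  SeqEdge-∈ (a ∷ b ∷ ps) (inj₁ (inj₂ (refl , refl))) = there (here refl) , here refl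
  SeqEdge-∈ (a ∷ b ∷ ps) (inj₂ e) with SeqEdge-∈ (b ∷ ps) e
  ... | x∈ , y∈ = there x∈ , there y∈

  SeqEdge-head : ∀ {e} q → Unique (x ∷ e ∷ q) → SeqEdge (x ∷ e ∷ q) x y → y ≡ e
  SeqEdge-head q u (inj₁ (inj₁ (_ , y≡e))) = y≡e
  SeqEdge-head q u (inj₁ (inj₂ (x≡e , _))) = ⊥-elim (Unique[x∷xs]⇒x∉xs u (here x≡e))
  SeqEdge-head q u (inj₂ e)                = ⊥-elim (Unique[x∷xs]⇒x∉xs u (proj₁ (SeqEdge-∈ _ e)))

  CycleEdge-∈ : ∀ c → CycleEdge c x y → x ∈ c
  CycleEdge-∈ (a ∷ ps) e with ∈-++⁻ (a ∷ ps) (proj₁ (SeqEdge-∈ (a ∷ ps ++ [ a ]) e))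
  ... | inj₁ x∈c         = x∈c
  ... | inj₂ (here refl) = here refl

  CycleEdge-comm : ∀ c → CycleEdge c x y → CycleEdge c y x
  CycleEdge-comm (a ∷ ps) = SeqEdge-comm (a ∷ ps ++ [ a ])

-- Edge sets are represented by their indicators at a fixed probe pair {x,y}, so that
-- symmetric difference becomes xor.
module EdgeParity {n : ℕ} (x y : Fin n) where

  open PermutationProperties (setoid (Fin n)) using (Unique-resp-↭; ∷↭∷ʳ)

  edge : Fin n → Fin n → Bool
  edge a b = does (sameEdge? a b x y)

  edge-reflects : ∀ a b → Reflects (SameEdge a b x y) (edge a b)
  edge-reflects a b = proof (sameEdge? a b x y)

  edge-comm : ∀ a b → edge a b ≡ edge b a
  edge-comm a b = det (edge-reflects a b) (reflects-⇔ SameEdge-comm SameEdge-comm (edge-reflects b a))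

  walk : List (Fin n) → Bool
  walk []           = false
  walk (a ∷ [])     = false
  walk (a ∷ b ∷ ps) = edge a b xor walk (b ∷ ps)

  walk-++ : ∀ ps a qs → walk (ps ++ a ∷ qs) ≡ walk (ps ++ [ a ]) xor walk (a ∷ qs)
  walk-++ []           a qs = refl
  walk-++ (p ∷ [])     a qs = cong (_xor walk (a ∷ qs)) (sym (xor-identityʳ (edge p a)))
  walk-++ (p ∷ q ∷ ps) a qs =
    trans (cong (edge p q xor_) (walk-++ (q ∷ ps) a qs)) (sym (xor-assoc (edge p q) _ _))

  walk-∷ʳ : ∀ ps a b → walk (ps ++ a ∷ [ b ]) ≡ walk (ps ++ [ a ]) xor edge a b
  walk-∷ʳ ps a b = trans (walk-++ ps a [ b ]) (cong (walk (ps ++ [ a ]) xor_) (xor-identityʳ (edge a b)))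

  walk-reverse : ∀ ps → walk (reverse ps) ≡ walk ps
  walk-reverse []           = refl
  walk-reverse (a ∷ [])     = refl
  walk-reverse (a ∷ b ∷ ps) = begin
    walk (reverse (a ∷ b ∷ ps))            ≡⟨ cong walk (unfold-reverse a (b ∷ ps)) ⟩
    walk (reverse (b ∷ ps) ++ [ a ])       ≡⟨ cong (λ l → walk (l ++ [ a ])) (unfold-reverse b ps) ⟩
    walk ((reverse ps ++ [ b ]) ++ [ a ])  ≡⟨ cong walk (++-assoc (reverse ps) [ b ] [ a ]) ⟩
    walk (reverse ps ++ b ∷ [ a ])         ≡⟨ walk-∷ʳ (reverse ps) b a ⟩
    walk (reverse ps ++ [ b ]) xor edge b a ≡⟨ cong (λ l → walk l xor edge b a) (unfold-reverse b ps) ⟨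
    walk (reverse (b ∷ ps)) xor edge b a   ≡⟨ cong₂ _xor_ (walk-reverse (b ∷ ps)) (edge-comm b a) ⟩
    walk (b ∷ ps) xor edge a b             ≡⟨ xor-comm (walk (b ∷ ps)) (edge a b) ⟩
    edge a b xor walk (b ∷ ps)             ∎
    where open ≡-Reasoning

  walk-reflects : ∀ ps → Unique ps → Reflects (SeqEdge ps x y) (walk ps)
  walk-reflects []           _       = ofⁿ λ ()
  walk-reflects (a ∷ [])     _       = ofⁿ λ ()
  walk-reflects (a ∷ b ∷ ps) (a∉ ∷ u) =
    xor-reflects-⊎ disjoint (edge-reflects a b) (walk-reflects (b ∷ ps) u)
    where
    disjoint : ¬ (SameEdge a b x y × SeqEdge (b ∷ ps) x y)
    disjoint (ab , e) = let x∈ , y∈ = SeqEdge-∈ (b ∷ ps) e in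
      Unique[x∷xs]⇒x∉xs (a∉ ∷ u) (SameEdge-∈ ab x∈ y∈)

  closedWalk : List (Fin n) → Bool
  closedWalk []       = false
  closedWalk (a ∷ ps) = walk (a ∷ ps ++ [ a ])

  closedWalk-split : ∀ a ps b qs →
    closedWalk (a ∷ ps ++ b ∷ qs) ≡ walk (a ∷ ps ++ [ b ]) xor walk (b ∷ qs ++ [ a ])
  closedWalk-split a ps b qs =
    trans (cong (λ l → walk (a ∷ l)) (++-assoc ps (b ∷ qs) [ a ])) (walk-++ (a ∷ ps) b (qs ++ [ a ]))

  closedWalk-∷ʳ : ∀ a ps b → closedWalk (a ∷ ps ++ [ b ]) ≡ walk (a ∷ ps ++ [ b ]) xor edge b a
  closedWalk-∷ʳ a ps b = trans (closedWalk-split a ps b []) (cong (walk (a ∷ ps ++ [ b ]) xor_) (xor-identityʳ (edge b a)))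

  closedWalk-rotate : ∀ ps qs → closedWalk (ps ++ qs) ≡ closedWalk (qs ++ ps)
  closedWalk-rotate []       qs       = cong closedWalk (sym (++-identityʳ qs))
  closedWalk-rotate (a ∷ ps) []       = cong closedWalk (++-identityʳ (a ∷ ps))
  closedWalk-rotate (a ∷ ps) (b ∷ qs) = begin
    closedWalk (a ∷ ps ++ b ∷ qs)                         ≡⟨ closedWalk-split a ps b qs ⟩
    walk (a ∷ ps ++ [ b ]) xor walk (b ∷ qs ++ [ a ])     ≡⟨ xor-comm (walk (a ∷ ps ++ [ b ])) _ ⟩
    walk (b ∷ qs ++ [ a ]) xor walk (a ∷ ps ++ [ b ])     ≡⟨ closedWalk-split b qs a ps ⟨
    closedWalk (b ∷ qs ++ a ∷ ps)                         ∎
    where open ≡-Reasoning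

  closedWalk-reverse : ∀ a ps → closedWalk (a ∷ reverse ps) ≡ closedWalk (a ∷ ps)
  closedWalk-reverse a ps = trans (cong walk (sym (reverse-arc a ps a))) (walk-reverse (a ∷ ps ++ [ a ]))

  closedWalk-reflects : ∀ c → IsCycle c → Reflects (CycleEdge c x y) (closedWalk c)
  closedWalk-reflects (a ∷ b ∷ e ∷ r) (u , s≤s (s≤s (s≤s z≤n))) =
    xor-reflects-⊎ disjoint (edge-reflects a b) (walk-reflects (b ∷ e ∷ r ++ [ a ]) u′)
    where
    u′ : Unique (b ∷ e ∷ r ++ [ a ])
    u′ = Unique-resp-↭ (∷↭∷ʳ a (b ∷ e ∷ r)) u
    a≢e : a ≢ e
    a≢e a≡e = Unique[x∷xs]⇒x∉xs u (there (here a≡e))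
    disjoint : ¬ (SameEdge a b x y × SeqEdge (b ∷ e ∷ r ++ [ a ]) x y)
    disjoint (inj₁ (refl , refl) , p) = a≢e (SeqEdge-head (r ++ [ a ]) u′ (SeqEdge-comm _ p))
    disjoint (inj₂ (refl , refl) , p) = a≢e (SeqEdge-head (r ++ [ a ]) u′ p)

module _ {n : ℕ} where

  open Permutation (setoid (Fin n)) using (_↭_; ↭-refl; ↭-sym; ↭-trans; ↭-prep)
  open PermutationProperties (setoid (Fin n)) using (Unique-resp-↭; ∈-resp-↭; xs↭ys⇒|xs|≡|ys|; ++-comm; ↭-reverse)
  open EdgeParity
  open import Data.List.Membership.DecPropositional (_≟_ {n}) using (_∈?_)

  SameCycle : List (Fin n) → List (Fin n) → Set
  SameCycle c c′ = c ↭ c′ × (∀ x y → closedWalk x y c ≡ closedWalk x y c′)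

  SameCycle-reflexive : ∀ {c c′} → c ≡ c′ → SameCycle c c′
  SameCycle-reflexive refl = ↭-refl , λ _ _ → refl

  SameCycle-trans : ∀ {c c′ c″} → SameCycle c c′ → SameCycle c′ c″ → SameCycle c c″
  SameCycle-trans (p , e) (p′ , e′) = ↭-trans p p′ , λ x y → trans (e x y) (e′ x y)

  SameCycle-rotate : ∀ ps qs → SameCycle (ps ++ qs) (qs ++ ps)
  SameCycle-rotate ps qs = ++-comm ps qs , λ x y → closedWalk-rotate x y ps qs

  SameCycle-reverse : ∀ a ps → SameCycle (a ∷ ps) (a ∷ reverse ps)
  SameCycle-reverse a ps = ↭-prep a (↭-sym (↭-reverse ps)) , λ x y → sym (closedWalk-reverse x y a ps)

  SameCycle-∈ : ∀ {c c′ a} → SameCycle c c′ → a ∈ c′ → a ∈ c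
  SameCycle-∈ (p , _) = ∈-resp-↭ (↭-sym p)

  SameCycle-Unique : ∀ {c c′} → SameCycle c c′ → Unique c → Unique c′
  SameCycle-Unique (p , _) = Unique-resp-↭ p

  SameCycle-IsCycle : ∀ {c c′} → SameCycle c c′ → IsCycle c → IsCycle c′
  SameCycle-IsCycle s@(p , _) (u , len) = SameCycle-Unique s u , subst (_≥ 3) (xs↭ys⇒|xs|≡|ys| p) len

  SameCycle-startingAt : ∀ {c w} → w ∈ c → ∃[ σ ] SameCycle c (w ∷ σ)
  SameCycle-startingAt w∈c with ∈-∃++ w∈c
  ... | α , ρ , refl = ρ ++ α , SameCycle-rotate α (_ ∷ ρ)

  SameCycle-openAt : ∀ {c w} → IsCycle c → w ∈ c → ∀ u →
    ∃[ d ] ∃[ ρ ] (d ≢ u × SameCycle c (w ∷ ρ ++ [ d ]))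
  SameCycle-openAt {c} {w} cyc w∈c u with SameCycle-startingAt w∈c
  ... | σ , c≈wσ = neighbour σ (SameCycle-IsCycle c≈wσ cyc) c≈wσ
    where
    neighbour : ∀ σ → IsCycle (w ∷ σ) → SameCycle c (w ∷ σ) →
                ∃[ d ] ∃[ ρ ] (d ≢ u × SameCycle c (w ∷ ρ ++ [ d ]))
    neighbour []          (_ , s≤s ())
    neighbour (_ ∷ [])    (_ , s≤s (s≤s ()))
    neighbour (s ∷ t ∷ σ) (_ ∷ uniq , _) c≈ with s ≟ u | ∷-∃∷ʳ t σ
    ... | no s≢u | _ = s , reverse (t ∷ σ) , s≢u ,
      SameCycle-trans c≈ (SameCycle-trans (SameCycle-reverse w (s ∷ t ∷ σ))
        (SameCycle-reflexive (cong (w ∷_) (unfold-reverse s (t ∷ σ)))))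
    ... | yes refl | τ , p , eq = p , s ∷ τ , p≢s ,
      SameCycle-trans c≈ (SameCycle-reflexive (cong (λ l → w ∷ s ∷ l) eq))
      where
      p≢s : p ≢ s
      p≢s refl = Unique[x∷xs]⇒x∉xs uniq (subst (p ∈_) (sym eq) (∈-++⁺ʳ τ (here refl)))

  SameCycle-splitAt : ∀ {c y v} → Unique c → y ∈ c → v ∈ c → v ≢ y → ∀ u →
    ∃[ γ₁ ] ∃[ γ₂ ] (u ∉ γ₁ × SameCycle c (y ∷ γ₁ ++ v ∷ γ₂))
  SameCycle-splitAt {y = y} {v} uc y∈c v∈c v≢y u with SameCycle-startingAt y∈c
  ... | σ , c≈ with ∈-resp-↭ (proj₁ c≈) v∈c
  ...   | here v≡y = ⊥-elim (v≢y v≡y)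
  ...   | there v∈σ with ∈-∃++ v∈σ
  ...     | γ₁ , γ₂ , refl with u ∈? γ₁
  ...       | no u∉γ₁ = γ₁ , γ₂ , u∉γ₁ , c≈
  ...       | yes u∈γ₁ = reverse γ₂ , reverse γ₁ , u∉γ₂ ∘ reverse⁻ ,
    SameCycle-trans c≈ (SameCycle-trans (SameCycle-reverse y (γ₁ ++ v ∷ γ₂))
      (SameCycle-reflexive (cong (y ∷_) (reverse-middle γ₁ v γ₂))))
    where
    u∉γ₂ : u ∉ γ₂
    u∉γ₂ u∈γ₂ = Unique-++⇒Disjoint (y ∷ γ₁) (SameCycle-Unique c≈ uc) (there u∈γ₁ , there u∈γ₂)

  IsCycle-avoiding : ∀ {c} → IsCycle c → ∀ a b → ∃[ y ] (y ∈ c × y ≢ a × y ≢ b)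
  IsCycle-avoiding {[]}         (_ , ())
  IsCycle-avoiding {_ ∷ []}     (_ , s≤s ())
  IsCycle-avoiding {_ ∷ _ ∷ []} (_ , s≤s (s≤s ()))
  IsCycle-avoiding {p ∷ q ∷ r ∷ _} ((p≢q ∷ p≢r ∷ _) ∷ (q≢r ∷ _) ∷ _ , _) a b
    with p ∈? a ∷ [ b ] | q ∈? a ∷ [ b ]
  ... | no p∉ab               | _                     = p , here refl , p∉ab ∘ here , p∉ab ∘ there ∘ here
  ... | yes _                 | no q∉ab               = q , there (here refl) , q∉ab ∘ here , q∉ab ∘ there ∘ here
  ... | yes (here refl)       | yes (here refl)       = ⊥-elim (p≢q refl)
  ... | yes (here refl)       | yes (there (here refl)) = r , there (there (here refl)) , p≢r ∘ sym , q≢r ∘ sym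
  ... | yes (there (here refl)) | yes (here refl)     = r , there (there (here refl)) , q≢r ∘ sym , p≢r ∘ sym
  ... | yes (there (here refl)) | yes (there (here refl)) = ⊥-elim (p≢q refl)

module _ {k : ℕ} where
  open import Data.List.Membership.DecPropositional (_≟_ {k}) using (_∈?_)

  remaining : List (Fin k) → List (Fin k)
  remaining ds = filter (λ i → ¬? (i ∈? ds)) (allFin k)

  remaining-unique : ∀ ds → Unique (remaining ds)
  remaining-unique ds = filter⁺ (λ i → ¬? (i ∈? ds)) (allFin⁺ k)

  remaining-∉ : ∀ {ds i} → i ∈ remaining ds → i ∉ ds
  remaining-∉ {ds} i∈ = proj₂ (∈-filter⁻ (λ i → ¬? (i ∈? ds)) {xs = allFin k} i∈)

  remaining-complete : ∀ ds i → i ∈ remaining ds ⊎ i ∈ ds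
  remaining-complete ds i with i ∈? ds
  ... | yes i∈ds = inj₂ i∈ds
  ... | no i∉ds  = inj₁ (∈-filter⁺ (λ i → ¬? (i ∈? ds)) (∈-allFin i) i∉ds)

module Construction {n k : ℕ} (Cs : Fin k → List (Fin n)) (cycles : VertexDisjointCycles Cs) where

  open EdgeParity

  isCycle : ∀ i → IsCycle (Cs i)
  isCycle = proj₁ cycles

  CyclesVertex : List (Fin k) → Fin n → Set
  CyclesVertex is a = ∃[ i ] (i ∈ is × a ∈ Cs i)

  CyclesEdge : List (Fin k) → Fin n → Fin n → Set
  CyclesEdge is x y = ∃[ i ] (i ∈ is × CycleEdge (Cs i) x y)

  cyclesParity : Fin n → Fin n → List (Fin k) → Bool
  cyclesParity x y []       = false
  cyclesParity x y (i ∷ is) = closedWalk x y (Cs i) xor cyclesParity x y is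

  same-cycle : ∀ {i j a} → a ∈ Cs i → a ∈ Cs j → i ≡ j
  same-cycle {i} {j} a∈i a∈j with i ≟ j
  ... | yes i≡j = i≡j
  ... | no i≢j  = ⊥-elim (proj₂ cycles i j i≢j _ a∈i a∈j)

  CyclesVertex-fresh : ∀ {i is a} → i ∉ is → a ∈ Cs i → ¬ CyclesVertex is a
  CyclesVertex-fresh i∉is a∈i (j , j∈is , a∈j) = i∉is (subst (_∈ _) (sym (same-cycle a∈i a∈j)) j∈is)

  cyclesParity-reflects : ∀ x y is → Unique is → Reflects (CyclesEdge is x y) (cyclesParity x y is)
  cyclesParity-reflects x y []       _        = ofⁿ λ { (_ , () , _) }
  cyclesParity-reflects x y (i ∷ is) u@(_ ∷ uis) =
    reflects-⇔ join split
      (xor-reflects-⊎ apart (closedWalk-reflects x y (Cs i) (isCycle i)) (cyclesParity-reflects x y is uis))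
    where
    apart : ¬ (CycleEdge (Cs i) x y × CyclesEdge is x y)
    apart (e , j , j∈is , e′) =
      CyclesVertex-fresh (Unique[x∷xs]⇒x∉xs u) (CycleEdge-∈ (Cs i) e) (j , j∈is , CycleEdge-∈ (Cs j) e′)
    join : CycleEdge (Cs i) x y ⊎ CyclesEdge is x y → CyclesEdge (i ∷ is) x y
    join (inj₁ e)             = i , here refl , e
    join (inj₂ (j , j∈ , e)) = j , there j∈ , e
    split : CyclesEdge (i ∷ is) x y → CycleEdge (Cs i) x y ⊎ CyclesEdge is x y
    split (j , here refl , e) = inj₁ e
    split (j , there j∈ , e)  = inj₂ (j , j∈ , e)

  module Covering (u v : Fin n) where

    open import Data.List.Membership.DecPropositional (_≟_ {n}) using (_∈?_)

    Allowed₂ : List (Fin k) → Fin n → Set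
    Allowed₂ done a = a ≡ v ⊎ CyclesVertex done a

    Allowed₁ : List (Fin k) → Fin n → Set
    Allowed₁ done a = a ≡ u ⊎ Allowed₂ done a

    -- The second path avoids u, so a fresh cycle can be appended to it in full.
    record Cover (done : List (Fin k)) (t : Fin n) : Set where
      field
        tail₁ tail₂ : List (Fin n)
        done-unique : Unique done
        unique₁     : Unique (t ∷ tail₁)
        unique₂     : Unique (t ∷ tail₂)
        vertices₁   : All (Allowed₁ done) (t ∷ tail₁)
        vertices₂   : All (Allowed₂ done) (t ∷ tail₂)
        parity      : ∀ x y → walk x y (t ∷ tail₁) xor walk x y (t ∷ tail₂) ≡ edge x y u v xor cyclesParity x y done

    start-at-v : u ≢ v → Cover [] v
    start-at-v u≢v = record
      { tail₁       = [ u ]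
      ; tail₂       = []
      ; done-unique = []
      ; unique₁     = Unique-∷⁺ (λ { (here v≡u) → u≢v (sym v≡u) }) ([] ∷ [])
      ; unique₂     = [] ∷ []
      ; vertices₁   = inj₂ (inj₁ refl) ∷ inj₁ refl ∷ []
      ; vertices₂   = inj₁ refl ∷ []
      ; parity      = λ x y → cong (_xor false) (trans (xor-identityʳ (edge x y v u)) (edge-comm x y v u))
      }

    start-on-cycle : ∀ {j t} → u ≢ v → v ∈ Cs j → t ∈ Cs j → t ≢ u → t ≢ v → Cover [ j ] t
    start-on-cycle {j} {t} u≢v v∈j t∈j t≢u t≢v with SameCycle-splitAt (proj₁ (isCycle j)) t∈j v∈j (t≢v ∘ sym) u
    ... | γ₁ , γ₂ , u∉γ₁ , c≈ = record
      { tail₁       = γ₁ ++ v ∷ [ u ]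
      ; tail₂       = reverse γ₂ ++ [ v ]
      ; done-unique = [] ∷ []
      ; unique₁     = subst Unique (++-assoc (t ∷ γ₁) [ v ] [ u ])
                        (Unique-++⁺ (Unique-arc t γ₁ v γ₂ uc) ([] ∷ []) λ { (u∈ , here refl) → u∉arc u∈ })
      ; unique₂     = subst Unique (reverse-arc v γ₂ t) (Unique-reverse (Unique-arc v γ₂ t γ₁ uc′))
      ; vertices₁   = All-++⁺ (All.map (inj₂ ∘ inj₂) arc₁-on-cycle) (inj₂ (inj₁ refl) ∷ inj₁ refl ∷ [])
      ; vertices₂   = All.tabulate λ a∈ → inj₂ (onCycle (SameCycle-∈ c≈′ (∈-arc v γ₂ t γ₁
                        (reverse⁻ (subst (_ ∈_) (sym (reverse-arc v γ₂ t)) a∈)))))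
      ; parity      = parity
      }
      where
      c≈′ : SameCycle (Cs j) (v ∷ γ₂ ++ t ∷ γ₁)
      c≈′ = SameCycle-trans c≈ (SameCycle-rotate (t ∷ γ₁) (v ∷ γ₂))
      uc : Unique (t ∷ γ₁ ++ v ∷ γ₂)
      uc = SameCycle-Unique c≈ (proj₁ (isCycle j))
      uc′ : Unique (v ∷ γ₂ ++ t ∷ γ₁)
      uc′ = SameCycle-Unique c≈′ (proj₁ (isCycle j))
      onCycle : ∀ {a} → a ∈ Cs j → CyclesVertex [ j ] a
      onCycle a∈ = j , here refl , a∈
      arc₁-on-cycle : All (CyclesVertex [ j ]) (t ∷ γ₁)
      arc₁-on-cycle = All.tabulate λ a∈ → onCycle (SameCycle-∈ c≈ (∈-++⁺ˡ a∈))
      u∉arc : u ∉ t ∷ γ₁ ++ [ v ]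
      u∉arc (here u≡t) = t≢u (sym u≡t)
      u∉arc (there u∈) with ∈-++⁻ γ₁ u∈
      ... | inj₁ u∈γ₁       = u∉γ₁ u∈γ₁
      ... | inj₂ (here u≡v) = u≢v u≡v
      parity : ∀ x y → walk x y (t ∷ γ₁ ++ v ∷ [ u ]) xor walk x y (t ∷ reverse γ₂ ++ [ v ])
                       ≡ edge x y u v xor cyclesParity x y [ j ]
      parity x y = begin
        walk x y (t ∷ γ₁ ++ v ∷ [ u ]) xor walk x y (t ∷ reverse γ₂ ++ [ v ])
          ≡⟨ cong₂ _xor_ (walk-∷ʳ x y (t ∷ γ₁) v u)
                         (trans (cong (walk x y) (sym (reverse-arc v γ₂ t))) (walk-reverse x y (v ∷ γ₂ ++ [ t ]))) ⟩
        (arc₁ xor edge x y v u) xor arc₂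
          ≡⟨ cong (_xor arc₂) (trans (xor-comm arc₁ _) (cong (_xor arc₁) (edge-comm x y v u))) ⟩
        (edge x y u v xor arc₁) xor arc₂
          ≡⟨ xor-assoc (edge x y u v) arc₁ arc₂ ⟩
        edge x y u v xor (arc₁ xor arc₂)
          ≡⟨ cong (edge x y u v xor_) (sym (trans (proj₂ c≈ x y) (closedWalk-split x y t γ₁ v γ₂))) ⟩
        edge x y u v xor closedWalk x y (Cs j)
          ≡⟨ cong (edge x y u v xor_) (sym (xor-identityʳ _)) ⟩
        edge x y u v xor cyclesParity x y [ j ] ∎
        where
        open ≡-Reasoning
        arc₁ = walk x y (t ∷ γ₁ ++ [ v ])
        arc₂ = walk x y (v ∷ γ₂ ++ [ t ])

    extend : ∀ {done t i w} → Cover done t → i ∉ done → v ∉ Cs i → w ∈ Cs i → w ≢ u → Cover (i ∷ done) w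
    extend {done} {t} {i} {w} C i∉done v∉i w∈i w≢u with SameCycle-openAt (isCycle i) w∈i u
    ... | d , ρ , d≢u , c≈ = record
      { tail₁       = d ∷ t ∷ tail₁
      ; tail₂       = ρ ++ d ∷ t ∷ tail₂
      ; done-unique = Unique-∷⁺ i∉done done-unique
      ; unique₁     = Unique-∷⁺ w∉ (Unique-∷⁺ (new₁ d∈i d≢u) unique₁)
      ; unique₂     = subst Unique (++-assoc (w ∷ ρ) [ d ] (t ∷ tail₂))
                        (Unique-++⁺ arc-unique unique₂ λ (a∈arc , a∈P₂) →
                           new₂ (SameCycle-∈ c≈ a∈arc) (All.lookup vertices₂ a∈P₂))
      ; vertices₁   = onCycle₁ w∈i ∷ onCycle₁ d∈i ∷ All.map lift₁ vertices₁
      ; vertices₂   = All-++⁺ {xs = w ∷ ρ} (All.tabulate λ a∈ → onCycle₂ (SameCycle-∈ c≈ (∈-++⁺ˡ a∈)))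
                              (onCycle₂ d∈i ∷ All.map lift₂ vertices₂)
      ; parity      = parity
      }
      where
      open Cover C hiding (parity)
      arc-unique : Unique (w ∷ ρ ++ [ d ])
      arc-unique = SameCycle-Unique c≈ (proj₁ (isCycle i))
      d∈i : d ∈ Cs i
      d∈i = SameCycle-∈ c≈ (there (∈-++⁺ʳ ρ (here refl)))
      lift₂ : ∀ {a} → Allowed₂ done a → Allowed₂ (i ∷ done) a
      lift₂ (inj₁ a≡v)           = inj₁ a≡v
      lift₂ (inj₂ (j , j∈ , a∈)) = inj₂ (j , there j∈ , a∈)
      lift₁ : ∀ {a} → Allowed₁ done a → Allowed₁ (i ∷ done) a
      lift₁ (inj₁ a≡u) = inj₁ a≡u
      lift₁ (inj₂ a)   = inj₂ (lift₂ a)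
      onCycle₂ : ∀ {a} → a ∈ Cs i → Allowed₂ (i ∷ done) a
      onCycle₂ a∈ = inj₂ (i , here refl , a∈)
      onCycle₁ : ∀ {a} → a ∈ Cs i → Allowed₁ (i ∷ done) a
      onCycle₁ a∈ = inj₂ (onCycle₂ a∈)
      new₂ : ∀ {a} → a ∈ Cs i → ¬ Allowed₂ done a
      new₂ a∈ (inj₁ refl) = v∉i a∈
      new₂ a∈ (inj₂ a)    = CyclesVertex-fresh i∉done a∈ a
      new₁ : ∀ {a} → a ∈ Cs i → a ≢ u → a ∉ t ∷ tail₁
      new₁ a∈ a≢u a∈P₁ with All.lookup vertices₁ a∈P₁
      ... | inj₁ a≡u = a≢u a≡u
      ... | inj₂ a   = new₂ a∈ a
      w∉ : w ∉ d ∷ t ∷ tail₁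
      w∉ (here w≡d)  = Unique[x∷xs]⇒x∉xs arc-unique (∈-++⁺ʳ ρ (here w≡d))
      w∉ (there w∈P₁) = new₁ w∈i w≢u w∈P₁
      parity : ∀ x y → walk x y (w ∷ d ∷ t ∷ tail₁) xor walk x y (w ∷ ρ ++ d ∷ t ∷ tail₂)
                       ≡ edge x y u v xor cyclesParity x y (i ∷ done)
      parity x y = begin
        walk x y (w ∷ d ∷ t ∷ tail₁) xor walk x y (w ∷ ρ ++ d ∷ t ∷ tail₂)
          ≡⟨ cong (walk x y (w ∷ d ∷ t ∷ tail₁) xor_) (walk-++ x y (w ∷ ρ) d (t ∷ tail₂)) ⟩
        (edge x y w d xor (edge x y d t xor P₁)) xor (arc xor (edge x y d t xor P₂))
          ≡⟨ xor-cancel-common (edge x y w d) (edge x y d t) P₁ arc P₂ ⟩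
        (edge x y w d xor arc) xor (P₁ xor P₂)
          ≡⟨ cong₂ _xor_ closing (Cover.parity C x y) ⟩
        closedWalk x y (Cs i) xor (edge x y u v xor cyclesParity x y done)
          ≡⟨ xor-exchange (closedWalk x y (Cs i)) (edge x y u v) _ ⟩
        edge x y u v xor cyclesParity x y (i ∷ done) ∎
        where
        open ≡-Reasoning
        P₁  = walk x y (t ∷ tail₁)
        P₂  = walk x y (t ∷ tail₂)
        arc = walk x y (w ∷ ρ ++ [ d ])
        closing : edge x y w d xor arc ≡ closedWalk x y (Cs i)
        closing = begin
          edge x y w d xor arc   ≡⟨ xor-comm (edge x y w d) arc ⟩
          arc xor edge x y w d   ≡⟨ cong (arc xor_) (edge-comm x y w d) ⟩
          arc xor edge x y d w   ≡⟨ closedWalk-∷ʳ x y w ρ d ⟨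
          closedWalk x y (w ∷ ρ ++ [ d ]) ≡⟨ proj₂ c≈ x y ⟨
          closedWalk x y (Cs i)  ∎

    extend-all : ∀ todo {done t} → Cover done t → Unique todo → Disjoint todo done →
                (∀ {i} → i ∈ todo → v ∉ Cs i) → ∃[ t′ ] Cover (todo ++ done) t′
    extend-all []         C _ _ _ = _ , C
    extend-all (i ∷ todo) {done} C uniq@(_ ∷ uniq′) apart v∉
      with extend-all todo C uniq′ (λ (i∈ , i∈′) → apart (there i∈ , i∈′)) (v∉ ∘ there)
    ... | _ , C′ with IsCycle-avoiding (isCycle i) u u
    ...   | w , w∈i , w≢u , _ = w , extend C′ i∉ (v∉ (here refl)) w∈i w≢u
      where
      i∉ : i ∉ todo ++ done
      i∉ i∈ with ∈-++⁻ todo i∈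
      ... | inj₁ i∈todo = Unique[x∷xs]⇒x∉xs uniq i∈todo
      ... | inj₂ i∈done = apart (here refl , i∈done)

    Cover⇒GoodCover : ¬ InEC Cs u v → ∀ {done t} (C : Cover done t) → (∀ i → i ∈ done) →
                  GoodCover Cs u v (t ∷ Cover.tail₁ C) (t ∷ Cover.tail₂ C)
    Cover⇒GoodCover uv∉E {done} {t} C all∈done =
      (unique₁ , λ ()) , (unique₂ , λ ()) , All.map allowed₁ vertices₁ , All.map allowed₂ vertices₂ , oddCovered
      where
      open Cover C
      allowed₂ : ∀ {a} → Allowed₂ done a → a ≡ u ⊎ a ≡ v ⊎ InVC Cs a
      allowed₂ (inj₁ a≡v)          = inj₂ (inj₁ a≡v)
      allowed₂ (inj₂ (i , _ , a∈)) = inj₂ (inj₂ (i , a∈))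
      allowed₁ : ∀ {a} → Allowed₁ done a → a ≡ u ⊎ a ≡ v ⊎ InVC Cs a
      allowed₁ (inj₁ a≡u) = inj₁ a≡u
      allowed₁ (inj₂ a)   = allowed₂ a
      oddCovered : OddCovered2 (Target Cs u v) (t ∷ tail₁) (t ∷ tail₂)
      oddCovered x y = reflects-same⇒⇔ target-reflects (subst (Reflects _) (parity x y) cover-reflects)
        where
        cover-reflects : Reflects (Xor {n} (SeqEdge (t ∷ tail₁) x y) (SeqEdge (t ∷ tail₂) x y))
                                  (walk x y (t ∷ tail₁) xor walk x y (t ∷ tail₂))
        cover-reflects = xor-reflects-Xor {n = n} (walk-reflects x y _ unique₁) (walk-reflects x y _ unique₂)
        uv∉cycles : ¬ (SameEdge u v x y × InEC Cs x y)
        uv∉cycles (inj₁ (refl , refl) , e)       = uv∉E e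
        uv∉cycles (inj₂ (refl , refl) , (i , e)) = uv∉E (i , CycleEdge-comm (Cs i) e)
        target-reflects : Reflects (Target Cs u v x y) (edge x y u v xor cyclesParity x y done)
        target-reflects = xor-reflects-⊎ uv∉cycles (edge-reflects x y u v)
          (reflects-⇔ (λ (i , _ , e) → i , e) (λ (i , e) → i , all∈done i , e)
                      (cyclesParity-reflects x y done done-unique))

    start : u ≢ v →
      ∃[ done ] ∃[ t ] (Cover done t × (∀ {i} → i ∈ done → v ∈ Cs i) × (∀ {i} → v ∈ Cs i → i ∈ done))
    start u≢v with any? (λ i → v ∈? Cs i)
    ... | no v∉cycles = [] , v , start-at-v u≢v , (λ ()) , λ v∈i → ⊥-elim (v∉cycles (_ , v∈i))
    ... | yes (j , v∈j) with IsCycle-avoiding (isCycle j) u v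
    ...   | t , t∈j , t≢u , t≢v =
      [ j ] , t , start-on-cycle u≢v v∈j t∈j t≢u t≢v ,
      (λ { (here refl) → v∈j }) , λ v∈i → here (same-cycle v∈i v∈j)

    cover : u ≢ v → ¬ InEC Cs u v → ∃[ P₁ ] ∃[ P₂ ] GoodCover Cs u v P₁ P₂
    cover u≢v uv∉E with start u≢v
    ... | done , _ , C , _ , v⇒done
      with extend-all (remaining done) C (remaining-unique done) (λ (i∈ , i∈′) → remaining-∉ i∈ i∈′)
                     (λ i∈ v∈i → remaining-∉ i∈ (v⇒done v∈i))
    ...   | _ , C′ = _ , _ , Cover⇒GoodCover uv∉E C′ complete
      where
      complete : ∀ i → i ∈ remaining done ++ done
      complete i with remaining-complete done i
      ... | inj₁ i∈ = ∈-++⁺ˡ i∈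
      ... | inj₂ i∈ = ∈-++⁺ʳ (remaining done) i∈

    EndingAt : Fin n → Set
    EndingAt z = ∃[ P₁ ] ∃[ P₂ ] (GoodCover Cs u v P₁ P₂ × IsEndpoint z P₁ × IsEndpoint z P₂)

    cover-ending-at : u ≢ v → ¬ InEC Cs u v → ∀ {j z} → z ∈ Cs j → v ∉ Cs j → z ≢ u → EndingAt z
    cover-ending-at u≢v uv∉E {j} {z} z∈j v∉j z≢u with start u≢v
    ... | done , _ , C , done⇒v , v⇒done
      with extend-all (remaining (j ∷ done)) C (remaining-unique (j ∷ done))
                     (λ (i∈ , i∈′) → remaining-∉ i∈ (there i∈′))
                     (λ i∈ v∈i → remaining-∉ i∈ (there (v⇒done v∈i)))
    ...   | _ , C′ = _ , _ , Cover⇒GoodCover uv∉E (extend C′ j∉ v∉j z∈j z≢u) complete , inj₁ refl , inj₁ refl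
      where
      j∉ : j ∉ remaining (j ∷ done) ++ done
      j∉ j∈ with ∈-++⁻ (remaining (j ∷ done)) j∈
      ... | inj₁ j∈rest = remaining-∉ j∈rest (here refl)
      ... | inj₂ j∈done = v∉j (done⇒v j∈done)
      complete : ∀ i → i ∈ j ∷ remaining (j ∷ done) ++ done
      complete i with remaining-complete (j ∷ done) i
      ... | inj₁ i∈rest         = there (∈-++⁺ˡ i∈rest)
      ... | inj₂ (here refl)    = here refl
      ... | inj₂ (there i∈done) = there (∈-++⁺ʳ (remaining (j ∷ done)) i∈done)

    cover-one-cycle : u ≢ v → ¬ InEC Cs u v → ∀ {j z} → (∀ i → i ≡ j) →
                    v ∈ Cs j → z ∈ Cs j → z ≢ u → z ≢ v → EndingAt z
    cover-one-cycle u≢v uv∉E only-j v∈j z∈j z≢u z≢v =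
      _ , _ , Cover⇒GoodCover uv∉E (start-on-cycle u≢v v∈j z∈j z≢u z≢v) (here ∘ only-j) , inj₁ refl , inj₁ refl

InEC-comm : ∀ {n k} {Cs : Fin k → List (Fin n)} {x y} → InEC Cs x y → InEC Cs y x
InEC-comm {Cs = Cs} (i , e) = i , CycleEdge-comm (Cs i) e

GoodCover-comm : ∀ {n k} {Cs : Fin k → List (Fin n)} {u v P₁ P₂} →
                 GoodCover Cs v u P₁ P₂ → GoodCover Cs u v P₁ P₂
GoodCover-comm (path₁ , path₂ , vertices₁ , vertices₂ , oddCovered) =
  path₁ , path₂ , All.map swap-uv vertices₁ , All.map swap-uv vertices₂ ,
  λ x y → let to , from = oddCovered x y in to ∘ swap-target , swap-target ∘ from
  where
  swap-uv : ∀ {a b c : Set} → a ⊎ b ⊎ c → b ⊎ a ⊎ c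
  swap-uv (inj₁ p)        = inj₂ (inj₁ p)
  swap-uv (inj₂ (inj₁ p)) = inj₁ p
  swap-uv (inj₂ (inj₂ p)) = inj₂ (inj₂ p)
  swap-target : ∀ {a b c : Set} → (a ⊎ b) ⊎ c → (b ⊎ a) ⊎ c
  swap-target (inj₁ e) = inj₁ (swap e)
  swap-target (inj₂ e) = inj₂ e

Fin-subsingleton : ∀ {k} → ¬ (k ≥ 2) → (i j : Fin k) → i ≡ j
Fin-subsingleton {suc zero}    _   zero zero = refl
Fin-subsingleton {suc (suc k)} k≱2 _    _    = ⊥-elim (k≱2 (s≤s (s≤s z≤n)))

lemma3p4 : (n k : ℕ) (Cs : Fin k → List (Fin n)) (u v : Fin n) →
    VertexDisjointCycles Cs → u ≢ v → ¬ InEC Cs u v →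
    (∃[ P₁ ] ∃[ P₂ ] GoodCover Cs u v P₁ P₂)
    × (∀ z → InVC Cs z → z ≢ u → z ≢ v →
        ¬ (k ≥ 2 × ∃[ j ] (u ∈ Cs j × v ∈ Cs j × z ∈ Cs j)) →
        ∃[ P₁ ] ∃[ P₂ ] (GoodCover Cs u v P₁ P₂ × IsEndpoint z P₁ × IsEndpoint z P₂))
lemma3p4 n k Cs u v cycles u≢v uv∉E = cover u≢v uv∉E , ending-at
  where
  open Construction Cs cycles
  open Covering u v using (cover; cover-ending-at; cover-one-cycle; EndingAt)
  open import Data.List.Membership.DecPropositional (_≟_ {n}) using (_∈?_)

  ending-at : ∀ z → InVC Cs z → z ≢ u → z ≢ v →
             ¬ (k ≥ 2 × ∃[ j ] (u ∈ Cs j × v ∈ Cs j × z ∈ Cs j)) → EndingAt z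
  ending-at z (j , z∈j) z≢u z≢v not-shared with v ∈? Cs j | u ∈? Cs j
  ... | no v∉j  | _       = cover-ending-at u≢v uv∉E z∈j v∉j z≢u
  ... | yes _   | no u∉j  =
    let P₁ , P₂ , good , ends = Covering.cover-ending-at v u (u≢v ∘ sym) (uv∉E ∘ InEC-comm {Cs = Cs}) z∈j u∉j z≢v
    in P₁ , P₂ , GoodCover-comm good , ends
  ... | yes v∈j | yes u∈j with 2 ≤? k
  ...   | yes k≥2 = ⊥-elim (not-shared (k≥2 , j , u∈j , v∈j , z∈j))
  ...   | no k≱2  = cover-one-cycle u≢v uv∉E (λ i → Fin-subsingleton k≱2 i j) v∈j z∈j z≢u z≢v
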